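{- Let $\Delta$ be an $i$-banner simplicial complex with $i\geq 2$, and let $v$ be a vertex of $\Delta$. Then $\mathrm{lk}_\Delta(v)$ is $(i-1)$-banner. Moreover, if $F\subseteq V(\mathrm{lk}_\Delta(v))$ is a face of $\Delta$ but not a face of $\mathrm{lk}_\Delta(v)$, then $\dim F\leq i-2$.
   Context: A simplicial complex $\Delta$ is a family of subsets of a vertex set closed under taking subsets and containing all singletons; $\dim F=|F|-1$. The link of a face $F$ is $\mathrm{lk}_\Delta F=\{G\in\Delta:F\cup G\in\Delta,F\cap G=\emptyset\}$, and $V(\mathrm{lk}_\Delta v)$ denotes its vertex set. A clique of $\Delta$ is a set $T$ of vertices every two of which form an edge; it is critical if $T\setminus\{u\}$ is a face for some $u\in T$. For a positive integer $m$, $\Delta$ is $m$-banner if every critical clique of size at least $m+1$ is a face of $\Delta$. -}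

module Defs where

open import Data.Nat using (ℕ; _≤_; _+_)
open import Data.Fin using (Fin)
open import Data.Fin.Subset using (Subset; ⁅_⁆; _∈_; _∉_; _⊆_; _∪_; _-_; ∣_∣)
open import Data.Product using (Σ; _×_)
open import Relation.Binary.PropositionalEquality using (_≢_)

Family : ℕ → Set₁
Family n = Subset n → Set

record IsSimplicialComplex {n : ℕ} (Δ : Family n) : Set where
  field
    down-closed : ∀ {F G : Subset n} → G ⊆ F → Δ F → Δ G
    singletons  : ∀ (u : Fin n) → Δ ⁅ u ⁆

IsVertex : ∀ {n} → Family n → Fin n → Set
IsVertex Δ u = Δ ⁅ u ⁆

lk : ∀ {n} → Family n → Subset n → Family n
lk Δ F G = Δ (F ∪ G) × (∀ u → u ∈ F → u ∉ G)

lkv : ∀ {n} → Family n → Fin n → Family n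
lkv Δ v = lk Δ ⁅ v ⁆

IsClique : ∀ {n} → Family n → Subset n → Set
IsClique Δ T =
  (∀ u → u ∈ T → IsVertex Δ u) ×
  (∀ u w → u ∈ T → w ∈ T → u ≢ w → Δ (⁅ u ⁆ ∪ ⁅ w ⁆))

IsCritical : ∀ {n} → Family n → Subset n → Set
IsCritical Δ T = Σ _ λ u → u ∈ T × Δ (T - u)

IsBanner : ∀ {n} → ℕ → Family n → Set
IsBanner m Δ = ∀ T → IsClique Δ T → IsCritical Δ T → m + 1 ≤ ∣ T ∣ → Δ T

module Submission where

-- Both parts of the theorem rest on one construction: the cone  v * T = {v} ∪ T
-- over a set T of vertices of lk(v).  Such a T avoids v, so |v * T| = |T| + 1, and
-- v * T is a face of Δ exactly when T is a face of lk(v).  Moreover v * T is a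
-- clique of Δ as soon as the vertices of T are pairwise adjacent in Δ.
--
-- Key lemma (cone-in-link): if Δ is m-banner, T ⊆ V(lk v) is pairwise adjacent in Δ,
-- |T| ≥ m and v * T is critical in Δ, then T is a face of lk(v): the cone is a
-- critical clique of size ≥ m + 1, hence a face of Δ.
--
-- * lk(v) is m-banner when Δ is (m+1)-banner: a critical clique T of lk(v) gives
--   a critical cone (remove the same vertex u, using (v * T) - u ⊆ v * (T - u)).
-- * a face F of Δ inside V(lk v) that is not a face of lk(v) has |F| < m when Δ is
--   m-banner: otherwise v * F is critical (remove v) and the key lemma applies.
-- The theorem is these two statements with m = i - 1 and m = i respectively
-- (the second giving |F| ≤ i - 1, i.e. dim F ≤ i - 2).

open import Defs
open import Data.Nat using (ℕ; _≤_; _<_; _∸_; _+_; suc; s≤s)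
open import Data.Nat.Properties using (≤-trans; +-comm; ≰⇒>; <⇒≤pred; ∸-monoˡ-≤)
open import Data.Fin using (Fin)
open import Data.Fin.Subset using (Subset; _⊆_; _∈_; _∉_; ∣_∣; ⁅_⁆; _∪_; _-_; _─_; inside; outside)
open import Data.Fin.Subset.Properties
  using ( x∈⁅x⁆; x∈⁅y⁆⇒x≡y; p⊆p∪q; q⊆p∪q; x∈p∪q⁻; p─q⊆p; x∈p∧x∉q⇒x∈p─q
        ; x∈p∧x≢y⇒x∈p-y; p⊆q⇒∣p∣≤∣q∣; x∈p⇒∣p-x∣<∣p∣ )
open import Data.Vec using (_∷_; here; there)
open import Data.Product using (_×_; _,_; proj₁; proj₂)
open import Data.Sum using (inj₁; inj₂)
open import Data.Empty using (⊥-elim)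
open import Relation.Nullary using (¬_)
open import Relation.Binary.PropositionalEquality using (_≢_; refl; sym; trans; subst)

x∈p─q⇒x∉q : ∀ {n} {x : Fin n} (p q : Subset n) → x ∈ p ─ q → x ∉ q
x∈p─q⇒x∉q (s ∷ p) (outside ∷ q) here ()
x∈p─q⇒x∉q (s ∷ p) (inside ∷ q) (there x∈) (there x∈q) = x∈p─q⇒x∉q p q x∈ x∈q
x∈p─q⇒x∉q (s ∷ p) (outside ∷ q) (there x∈) (there x∈q) = x∈p─q⇒x∉q p q x∈ x∈q

pair⊆ : ∀ {n} {a b : Fin n} {S : Subset n} → a ∈ S → b ∈ S → ⁅ a ⁆ ∪ ⁅ b ⁆ ⊆ S
pair⊆ {a = a} {b} a∈S b∈S z∈ with x∈p∪q⁻ ⁅ a ⁆ ⁅ b ⁆ z∈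
... | inj₁ z∈a = subst (_∈ _) (sym (x∈⁅y⁆⇒x≡y a z∈a)) a∈S
... | inj₂ z∈b = subst (_∈ _) (sym (x∈⁅y⁆⇒x≡y b z∈b)) b∈S

cone : ∀ {n} → Fin n → Subset n → Subset n
cone v T = ⁅ v ⁆ ∪ T

∣cone∣ : ∀ {n} {v : Fin n} {T : Subset n} → v ∉ T → suc ∣ T ∣ ≤ ∣ cone v T ∣
∣cone∣ {v = v} {T} v∉T = ≤-trans (s≤s (p⊆q⇒∣p∣≤∣q∣ T⊆cone-v)) (x∈p⇒∣p-x∣<∣p∣ (p⊆p∪q T (x∈⁅x⁆ v)))
  where
  T⊆cone-v : T ⊆ cone v T - v
  T⊆cone-v z∈T = x∈p∧x≢y⇒x∈p-y (q⊆p∪q ⁅ v ⁆ T z∈T) (λ { refl → v∉T z∈T })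

cone-apex⊆ : ∀ {n} (v : Fin n) (T : Subset n) → cone v T - v ⊆ T
cone-apex⊆ v T z∈ with x∈p∪q⁻ ⁅ v ⁆ T (p─q⊆p (cone v T) ⁅ v ⁆ z∈)
... | inj₁ z∈v = ⊥-elim (x∈p─q⇒x∉q (cone v T) ⁅ v ⁆ z∈ z∈v)
... | inj₂ z∈T = z∈T

cone-base⊆ : ∀ {n} (v u : Fin n) (T : Subset n) → cone v T - u ⊆ cone v (T - u)
cone-base⊆ v u T z∈ with x∈p∪q⁻ ⁅ v ⁆ T (p─q⊆p (cone v T) ⁅ u ⁆ z∈)
... | inj₁ z∈v = p⊆p∪q (T - u) z∈v
... | inj₂ z∈T = q⊆p∪q ⁅ v ⁆ (T - u) (x∈p∧x∉q⇒x∈p─q z∈T (x∈p─q⇒x∉q (cone v T) ⁅ u ⁆ z∈))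

LinkVertices : ∀ {n} → Family n → Fin n → Subset n → Set
LinkVertices Δ v T = ∀ u → u ∈ T → IsVertex (lkv Δ v) u

PairwiseAdjacent : ∀ {n} → Family n → Subset n → Set
PairwiseAdjacent Δ T = ∀ a b → a ∈ T → b ∈ T → a ≢ b → Δ (⁅ a ⁆ ∪ ⁅ b ⁆)

apex∉link : ∀ {n} (Δ : Family n) (v : Fin n) {T : Subset n} → LinkVertices Δ v T → v ∉ T
apex∉link Δ v vertT v∈T = proj₂ (vertT v v∈T) v (x∈⁅x⁆ v) (x∈⁅x⁆ v)

cone-face⇒link : ∀ {n} (Δ : Family n) (v : Fin n) {T : Subset n} → v ∉ T → Δ (cone v T) → lkv Δ v T
cone-face⇒link Δ v v∉T Δcone = Δcone , λ x x∈v x∈T → v∉T (subst (_∈ _) (x∈⁅y⁆⇒x≡y v x∈v) x∈T)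

module _ {n : ℕ} {Δ : Family n} (sc : IsSimplicialComplex Δ) (v : Fin n) where
  open IsSimplicialComplex sc

  link-face⇒face : ∀ {G} → lkv Δ v G → Δ G
  link-face⇒face (ΔvG , _) = down-closed (q⊆p∪q ⁅ v ⁆ _) ΔvG

  cone-clique : ∀ {T} → LinkVertices Δ v T → PairwiseAdjacent Δ T → IsClique Δ (cone v T)
  cone-clique {T} vertT adjT = (λ u _ → singletons u) , edge
    where
    apex-edge : ∀ a b → a ∈ ⁅ v ⁆ → b ∈ T → Δ (⁅ a ⁆ ∪ ⁅ b ⁆)
    apex-edge a b a∈v b∈T = down-closed
      (pair⊆ (subst (_∈ _) (sym (x∈⁅y⁆⇒x≡y v a∈v)) (p⊆p∪q ⁅ b ⁆ (x∈⁅x⁆ v))) (q⊆p∪q ⁅ v ⁆ ⁅ b ⁆ (x∈⁅x⁆ b)))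
      (proj₁ (vertT b b∈T))
    edge : PairwiseAdjacent Δ (cone v T)
    edge a b a∈ b∈ a≢b with x∈p∪q⁻ ⁅ v ⁆ T a∈ | x∈p∪q⁻ ⁅ v ⁆ T b∈
    ... | inj₁ a∈v | inj₁ b∈v = ⊥-elim (a≢b (trans (x∈⁅y⁆⇒x≡y v a∈v) (sym (x∈⁅y⁆⇒x≡y v b∈v))))
    ... | inj₁ a∈v | inj₂ b∈T = apex-edge a b a∈v b∈T
    ... | inj₂ a∈T | inj₁ b∈v =
      down-closed (pair⊆ (q⊆p∪q ⁅ b ⁆ ⁅ a ⁆ (x∈⁅x⁆ a)) (p⊆p∪q ⁅ a ⁆ (x∈⁅x⁆ b))) (apex-edge b a b∈v a∈T)
    ... | inj₂ a∈T | inj₂ b∈T = adjT a b a∈T b∈T a≢b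

  cone-in-link : ∀ {m T} → IsBanner m Δ → LinkVertices Δ v T → PairwiseAdjacent Δ T
    → IsCritical Δ (cone v T) → m ≤ ∣ T ∣ → lkv Δ v T
  cone-in-link {m} {T} banner vertT adjT critical m≤∣T∣ =
    cone-face⇒link Δ v v∉T (banner (cone v T) (cone-clique vertT adjT) critical size)
    where
    v∉T : v ∉ T
    v∉T = apex∉link Δ v vertT
    size : m + 1 ≤ ∣ cone v T ∣
    size = subst (_≤ ∣ cone v T ∣) (+-comm 1 m) (≤-trans (s≤s m≤∣T∣) (∣cone∣ v∉T))

  link-banner : ∀ {m} → IsBanner (suc m) Δ → IsBanner m (lkv Δ v)
  link-banner {m} banner T (vertT , adjT) (u , u∈T , lkT-u) size =
    cone-in-link banner vertT adjΔ critical (subst (_≤ ∣ T ∣) (+-comm m 1) size)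
    where
    adjΔ : PairwiseAdjacent Δ T
    adjΔ a b a∈T b∈T a≢b = link-face⇒face (adjT a b a∈T b∈T a≢b)
    critical : IsCritical Δ (cone v T)
    critical = u , q⊆p∪q ⁅ v ⁆ T u∈T , down-closed (cone-base⊆ v u T) (proj₁ lkT-u)

  non-link-face-small : ∀ {m F} → IsBanner m Δ → LinkVertices Δ v F → Δ F → ¬ lkv Δ v F → ∣ F ∣ < m
  non-link-face-small {m} {F} banner vertF ΔF F∉lk = ≰⇒> large⇒link
    where
    critical : IsCritical Δ (cone v F)
    critical = v , p⊆p∪q F (x∈⁅x⁆ v) , down-closed (cone-apex⊆ v F) ΔF
    large⇒link : ¬ m ≤ ∣ F ∣
    large⇒link m≤∣F∣ =
      F∉lk (cone-in-link banner vertF (λ a b a∈F b∈F _ → down-closed (pair⊆ a∈F b∈F) ΔF) critical m≤∣F∣)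

lemma3p4 : ∀ {n : ℕ} (Δ : Family n) (i : ℕ) (v : Fin n)
    → IsSimplicialComplex Δ → IsBanner i Δ → 2 ≤ i
    → IsBanner (i ∸ 1) (lkv Δ v)
      × (∀ (F : Subset n) → (∀ u → u ∈ F → IsVertex (lkv Δ v) u)
         → Δ F → ¬ lkv Δ v F → ∣ F ∣ ∸ 1 ≤ i ∸ 2)
lemma3p4 Δ (suc (suc k)) v sc banner (s≤s (s≤s _)) =
  link-banner sc v {m = suc k} banner ,
  λ F vertF ΔF F∉lk →
    ∸-monoˡ-≤ 1 (<⇒≤pred (non-link-face-small sc v {m = suc (suc k)} banner vertF ΔF F∉lk))
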